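{- There is an absolute constant $c$ such that the following holds. Let $k$ be a positive integer and let $G$ be a $k$-colourable compact graph on $n$ vertices. Then $R_{k+1}(G)$ is connected and has diameter at most $c\, n^2$ (i.e. the diameter of $R_{k+1}(G)$ is $O(n^2)$).
   Context: All graphs are finite and simple. A $k$-colouring of $G$ is a map $f: V(G)\to\{1,\dots,k\}$ with $f(u)\ne f(v)$ for every edge $uv$. The reconfiguration graph $R_k(G)$ has vertex set the $k$-colourings of $G$, two colourings adjacent iff they differ on exactly one vertex. A hole is an induced cycle of length at least $5$; an antihole is an induced subgraph whose complement is a hole. A graph is weakly chordal if it has no hole and no antihole. $N_H(u)$ denotes the set of neighbours of $u$ in $H$. A 2-pair of a graph $H$ is a pair $\{x,y\}$ of distinct nonadjacent vertices such that every chordless (induced) path from $x$ to $y$ has length $2$ (two edges). For a 2-pair $\{x,y\}$ of $H$, let $S(x,y) = N_H(x)\cap N_H(y)$ (which separates $x$ from $y$), and let $C_x$ be the connected component of $H - S(x,y)$ containing $x$. A weakly chordal graph $G$ is compact if every subgraph $H$ of $G$ either (i) is a complete graph, or (ii) contains a 2-pair $\{x,y\}$ with $N_H(x)\subseteq N_H(y)$, or (iii) contains a 2-pair $\{x,y\}$ such that $C_x\cup S(x,y)$ induces a clique on at most three vertices. A $k$-colourable compact graph is a compact graph that admits a $k$-colouring. -}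

module Defs where

open import Data.Nat using (ℕ; zero; suc; _+_; _*_; _≤_)
open import Data.Fin using (Fin; toℕ; fromℕ; inject₁) renaming (zero to fzero; suc to fsuc)
open import Data.Bool using (Bool; true; false)
open import Data.Product using (Σ; ∃; _×_; _,_)
open import Data.Sum using (_⊎_)
open import Relation.Binary.PropositionalEquality using (_≡_; _≢_)
open import Relation.Nullary using (¬_)
open import Function.Bundles using (_⇔_)

record Graph (n : ℕ) : Set where
  field
    adj   : Fin n → Fin n → Bool
    sym   : ∀ u v → adj u v ≡ adj v u
    irrefl : ∀ v → adj v v ≡ false

open Graph public

module _ {n : ℕ} (G : Graph n) where

  E : Fin n → Fin n → Set
  E u v = adj G u v ≡ true

  Injective : {m : ℕ} → (Fin m → Fin n) → Set
  Injective {m} g = ∀ (i j : Fin m) → g i ≡ g j → i ≡ j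

  CycAdj : (m : ℕ) → Fin m → Fin m → Set
  CycAdj m i j = (suc (toℕ i) ≡ toℕ j) ⊎ (suc (toℕ j) ≡ toℕ i)
               ⊎ ((toℕ i ≡ 0) × (suc (toℕ j) ≡ m))
               ⊎ ((toℕ j ≡ 0) × (suc (toℕ i) ≡ m))

  HasHole : Set
  HasHole = Σ ℕ λ m → (5 ≤ m) × Σ (Fin m → Fin n) λ g → Injective g ×
              (∀ i j → E (g i) (g j) ⇔ CycAdj m i j)

  HasAntihole : Set
  HasAntihole = Σ ℕ λ m → (5 ≤ m) × Σ (Fin m → Fin n) λ g → Injective g ×
                  (∀ i j → i ≢ j → E (g i) (g j) ⇔ (¬ CycAdj m i j))

  WeaklyChordal : Set
  WeaklyChordal = ¬ HasHole × ¬ HasAntihole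

  -- Induced subgraphs H = G[S], S a vertex subset given as a predicate.

  module _ (S : Fin n → Set) where

    IsComplete : Set
    IsComplete = ∀ u v → S u → S v → u ≢ v → E u v

    IsChordlessPath : (m : ℕ) → (Fin (suc m) → Fin n) → Set
    IsChordlessPath m p = Injective p × (∀ i → S (p i)) ×
      (∀ i j → E (p i) (p j) ⇔ ((suc (toℕ i) ≡ toℕ j) ⊎ (suc (toℕ j) ≡ toℕ i)))

    TwoPair : Fin n → Fin n → Set
    TwoPair x y = S x × S y × x ≢ y × ¬ E x y ×
      (∀ m (p : Fin (suc m) → Fin n) → p fzero ≡ x → p (fromℕ m) ≡ y →
         IsChordlessPath m p → m ≡ 2)

    NbrH : Fin n → Fin n → Set
    NbrH x z = S z × E x z

    Sep : Fin n → Fin n → Fin n → Set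
    Sep x y z = NbrH x z × NbrH y z

    -- z reachable from x in H − S(x,y) (i.e. z ∈ C_x)
    data Reach (x y : Fin n) : Fin n → Set where
      here : S x → ¬ Sep x y x → Reach x y x
      step : ∀ {u v} → Reach x y u → S v → ¬ Sep x y v → E u v → Reach x y v

    CxS : Fin n → Fin n → Fin n → Set
    CxS x y z = Reach x y z ⊎ Sep x y z

    CondII : Set
    CondII = Σ (Fin n) λ x → Σ (Fin n) λ y → TwoPair x y ×
               (∀ z → NbrH x z → NbrH y z)

    CondIII : Set
    CondIII = Σ (Fin n) λ x → Σ (Fin n) λ y → TwoPair x y ×
      (∀ u v → CxS x y u → CxS x y v → u ≢ v → E u v) ×
      (∀ (g : Fin 4 → Fin n) → Injective g → ¬ (∀ i → CxS x y (g i)))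

  Compact : Set₁
  Compact = WeaklyChordal ×
    (∀ (S : Fin n → Set) → IsComplete S ⊎ CondII S ⊎ CondIII S)

  IsColouring : (k : ℕ) → (Fin n → Fin k) → Set
  IsColouring k f = ∀ u v → E u v → f u ≢ f v

  Colourable : ℕ → Set
  Colourable k = Σ (Fin n → Fin k) (IsColouring k)

  DifferOnOne : {k : ℕ} → (Fin n → Fin k) → (Fin n → Fin k) → Set
  DifferOnOne α β = Σ (Fin n) λ v → α v ≢ β v × (∀ u → u ≢ v → α u ≡ β u)

  -- α and β are joined in R_k(G) by a walk of length m
  -- (colourings compared pointwise)
  WalkR : (k : ℕ) → (Fin n → Fin k) → (Fin n → Fin k) → ℕ → Set
  WalkR k α β m = Σ (Fin (suc m) → Fin n → Fin k) λ s →
    (∀ i → IsColouring k (s i)) ×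
    (∀ v → s fzero v ≡ α v) × (∀ v → s (fromℕ m) v ≡ β v) ×
    (∀ (i : Fin m) → DifferOnOne (s (inject₁ i)) (s (fsuc i)))

  ConnectedDiamAtMost : (k : ℕ) → ℕ → Set
  ConnectedDiamAtMost k d = ∀ α β → IsColouring k α → IsColouring k β →
    Σ ℕ λ m → (m ≤ d) × WalkR k α β m

-- We prove more, by induction on a vertex set T: any two proper (k+2)-colourings of G[T] are joined by
-- a walk of at most 2|T|² recolourings, each vertex being recoloured at most 2|T| times. Compactness
-- applied to G[T] gives a clique, a vertex x dominated by a non-neighbour y, a pendant vertex x, or a
-- triangle x w s in which s is the only further neighbour of x and w. A clique has at most k+1 vertices,
-- so a colour is missing on it: each vertex in turn gets its target colour, after the current holder
-- of that colour is moved to the missing one. Otherwise x (and w) is removed and a walk for the smaller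
-- set, found by induction, is replayed on T: x keeps copying the colour of y, or, whenever w (pendant
-- case) or s (triangle case) is about to take the colour of a removed vertex, that vertex first moves
-- to a spare colour. Removed vertices thus move at most as often as y, w or s, which keeps the
-- per-vertex bound linear and the length quadratic.

module Submission where

open import Defs renaming (sym to adj-sym)
open import Data.Bool using (true)
import Data.Bool.Properties as Bool
open import Data.Nat using (ℕ; zero; suc; _+_; _*_; _≤_; _<_; z≤n; s≤s)
open import Data.Nat.Properties
  using (≤-refl; ≤-trans; ≤-reflexive; m≤m+n; m≤m*n; m≤n⇒m≤1+n; n≤1+n; +-mono-≤; +-monoʳ-≤; +-comm; +-suc;
         *-mono-≤; *-monoʳ-≤; module ≤-Reasoning)
open import Data.Nat.Tactic.RingSolver using (solve-∀)
open import Data.Fin using (Fin; inject₁) renaming (zero to fzero; suc to fsuc)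
open import Data.Fin.Properties using (_≟_; any?; ¬∀⟶∃¬; pigeonhole) renaming (<⇒≢ to <⇒≢ᶠ)
open import Data.Fin.Subset using (Subset; _∈_; _∉_; _⊆_; _⊂_; _─_; _-_; ∣_∣; ⊤; inside; outside)
open import Data.Fin.Subset.Properties
  using (_∈?_; ∈⊤; ∣⊤∣≡n; p─q⊆p; x∈p∧x≢y⇒x∈p-y; x∈p⇒p-x⊂p; p⊂q⇒∣p∣<∣q∣; ⊂-trans; x∉⁅y⁆⇒x≢y)
open import Data.Fin.Subset.Induction using (⊂-wellFounded)
open import Data.Vec using (_∷_; []; here; there; lookup)
open import Data.Vec.Functional using (updateAt) renaming (_∷_ to _∷ᶠ_)
open import Data.Vec.Functional.Properties using (updateAt-updates; updateAt-minimal)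
open import Data.Vec.Relation.Unary.All using ([]; _∷_)
open import Data.Vec.Relation.Unary.AllPairs using ([]; _∷_)
open import Data.Vec.Relation.Unary.Unique.Propositional.Properties using (lookup-injective)
open import Data.List using (List; []; _∷_; _++_; [_]; length; filter; foldl)
open import Data.List.Properties using (length-++; foldl-++; length-filter; filter-accept; filter-reject; filter-++)
open import Data.Product using (Σ; ∃; _×_; _,_; proj₁; proj₂; map₁; map₂)
open import Data.Sum using (_⊎_; inj₁; inj₂)
open import Data.Empty using (⊥; ⊥-elim)
open import Data.Unit using (tt) renaming (⊤ to Unit)
open import Function using (_∘_; const)
open import Induction.WellFounded using (Acc; acc)
open import Relation.Nullary using (¬_; Dec; yes; no)
open import Relation.Nullary.Decidable using (_×-dec_; ¬?; decidable-stable)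
open import Relation.Binary.PropositionalEquality
  using (_≡_; _≢_; refl; sym; trans; cong; subst; subst₂; ≢-sym)

private
  variable
    n m K : ℕ
    G : Graph n

edge-sym : ∀ (G : Graph n) {u v} → E G u v → E G v u
edge-sym G {u} {v} uv = trans (adj-sym G v u) uv

edge⇒≢ : ∀ (G : Graph n) {u v} → E G u v → u ≢ v
edge⇒≢ G {u} uv refl with trans (sym uv) (irrefl G u)
... | ()

x∈p─q⇒x∉q : ∀ {x : Fin n} (p q : Subset n) → x ∈ p ─ q → x ∉ q
x∈p─q⇒x∉q (inside ∷ p) (outside ∷ q) here ()
x∈p─q⇒x∉q (_ ∷ p) (_ ∷ q) (there x∈p─q) (there x∈q) = x∈p─q⇒x∉q p q x∈p─q x∈q

x∈p-y⇒x≢y : ∀ {x y : Fin n} {p : Subset n} → x ∈ p - y → x ≢ y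
x∈p-y⇒x≢y {p = p} x∈p-y = x∉⁅y⁆⇒x≢y (x∈p─q⇒x∉q p _ x∈p-y)

x∈p-y⇒x∈p : ∀ {x y : Fin n} {p : Subset n} → x ∈ p - y → x ∈ p
x∈p-y⇒x∈p {p = p} = p─q⊆p p _

x∉p-x : ∀ {x : Fin n} {p : Subset n} → x ∉ p - x
x∉p-x x∈p-x = x∈p-y⇒x≢y x∈p-x refl

missing-colour : m < K → (h : Fin m → Fin K) → ∃ λ d → ∀ i → h i ≢ d
missing-colour {m} {K} m<K h
  with ¬∀⟶∃¬ K (λ d → ∃ λ i → h i ≡ d) (λ d → any? (λ i → h i ≟ d)) not-onto
  where
  not-onto : ¬ (∀ d → ∃ λ i → h i ≡ d)
  not-onto onto with pigeonhole m<K (proj₁ ∘ onto)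
  ... | d , d′ , d<d′ , same =
    <⇒≢ᶠ d<d′ (trans (sym (proj₂ (onto d))) (trans (cong h same) (proj₂ (onto d′))))
... | d , d∉image = d , λ i hi≡d → d∉image (i , hi≡d)

avoid₂ : 2 < K → (a b : Fin K) → ∃ λ d → a ≢ d × b ≢ d
avoid₂ 2<K a b with missing-colour 2<K (lookup (a ∷ b ∷ []))
... | d , new = d , new fzero , new (fsuc fzero)

avoid₃ : 3 < K → (a b c : Fin K) → ∃ λ d → a ≢ d × b ≢ d × c ≢ d
avoid₃ 3<K a b c with missing-colour 3<K (lookup (a ∷ b ∷ c ∷ []))
... | d , new = d , new fzero , new (fsuc fzero) , new (fsuc (fsuc fzero))

distinct₂⇒2≤ : (a b : Fin m) → a ≢ b → 2 ≤ m
distinct₂⇒2≤ {suc zero} fzero fzero a≢b = ⊥-elim (a≢b refl)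
distinct₂⇒2≤ {suc (suc m)} _ _ _ = s≤s (s≤s z≤n)

distinct₃⇒3≤ : (a b c : Fin m) → a ≢ b → a ≢ c → b ≢ c → 3 ≤ m
distinct₃⇒3≤ {suc (suc (suc m))} _ _ _ _ _ _ = s≤s (s≤s (s≤s z≤n))
distinct₃⇒3≤ {suc zero} fzero fzero _ a≢b _ _ = ⊥-elim (a≢b refl)
distinct₃⇒3≤ {suc (suc zero)} fzero fzero _ a≢b _ _ = ⊥-elim (a≢b refl)
distinct₃⇒3≤ {suc (suc zero)} fzero (fsuc fzero) fzero _ a≢c _ = ⊥-elim (a≢c refl)
distinct₃⇒3≤ {suc (suc zero)} fzero (fsuc fzero) (fsuc fzero) _ _ b≢c = ⊥-elim (b≢c refl)
distinct₃⇒3≤ {suc (suc zero)} (fsuc fzero) fzero fzero _ _ b≢c = ⊥-elim (b≢c refl)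
distinct₃⇒3≤ {suc (suc zero)} (fsuc fzero) fzero (fsuc fzero) _ a≢c _ = ⊥-elim (a≢c refl)
distinct₃⇒3≤ {suc (suc zero)} (fsuc fzero) (fsuc fzero) _ a≢b _ _ = ⊥-elim (a≢b refl)

clique-missing-colour : ∀ {T : Subset n} {γ : Fin n → Fin m} → IsColouring G m γ →
  IsComplete G (_∈ T) → (f : Fin n → Fin (suc m)) → ∃ λ d → ∀ {v} → v ∈ T → f v ≢ d
clique-missing-colour {n} {m} {T = T} {γ} γ-proper clique f
  with ¬∀⟶∃¬ (suc m) (λ d → ∃ λ v → v ∈ T × f v ≡ d) (λ d → any? (λ v → v ∈? T ×-dec f v ≟ d))
              not-all
  where
  not-all : ¬ (∀ d → ∃ λ v → v ∈ T × f v ≡ d)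
  not-all used with pigeonhole ≤-refl (γ ∘ proj₁ ∘ used)
  ... | d , d′ , d<d′ , same-γ with used d | used d′
  ...   | v , v∈T , fv≡d | v′ , v′∈T , fv′≡d′ with v ≟ v′
  ...     | yes refl = <⇒≢ᶠ d<d′ (trans (sym fv≡d) fv′≡d′)
  ...     | no v≢v′ = γ-proper v v′ (clique v v′ v∈T v′∈T v≢v′) same-γ
... | d , unused = d , λ v∈T fv≡d → unused (_ , v∈T , fv≡d)

-- r + 1 vertices are removed in an inductive step, and at most r + 2 moves are added to the replayed walk.
quadratic-budget : ∀ r {s t L d} → r + s < t → L ≤ 2 * (s * s) + 2 * s → d ≤ 2 + r → L + d ≤ 2 * (t * t)
quadratic-budget r {s} {t} r+s<t L≤ d≤ = begin
  _ ≤⟨ +-mono-≤ L≤ d≤ ⟩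
  2 * (s * s) + 2 * s + (2 + r)   ≤⟨ m≤m+n _ _ ⟩
  _                               ≡⟨ identity r s ⟩
  2 * (suc (r + s) * suc (r + s)) ≤⟨ *-monoʳ-≤ 2 (*-mono-≤ r+s<t r+s<t) ⟩
  2 * (t * t)                     ∎
  where
  open ≤-Reasoning
  identity : ∀ r s → 2 * (s * s) + 2 * s + (2 + r) + (2 * (r * r) + 4 * (r * s) + 2 * s + 3 * r)
                     ≡ 2 * (suc (r + s) * suc (r + s))
  identity = solve-∀

linear-budget : ∀ r {s t c d} → r + s < t → c ≤ 2 * s → d ≤ 2 + r → c + d ≤ 2 * t
linear-budget r {s} {t} r+s<t c≤ d≤ = begin
  _                 ≤⟨ +-mono-≤ c≤ d≤ ⟩
  2 * s + (2 + r)   ≤⟨ m≤m+n _ r ⟩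
  _                 ≡⟨ identity r s ⟩
  2 * suc (r + s)   ≤⟨ *-monoʳ-≤ 2 r+s<t ⟩
  2 * t             ∎
  where
  open ≤-Reasoning
  identity : ∀ r s → 2 * s + (2 + r) + r ≡ 2 * suc (r + s)
  identity = solve-∀

record Dominated (G : Graph n) (T : Subset n) (x y : Fin n) : Set where
  field
    x∈T       : x ∈ T
    y∈T       : y ∈ T
    x≢y       : x ≢ y
    dominated : ∀ {u} → u ∈ T → E G x u → E G y u

record Pendant (G : Graph n) (T : Subset n) (x w : Fin n) : Set where
  field
    x∈T    : x ∈ T
    w∈T    : w ∈ T
    x∼w    : E G x w
    unique : ∀ {u} → u ∈ T → E G x u → u ≡ w

record PendantTriangle (G : Graph n) (T : Subset n) (x w s : Fin n) : Set where
  field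
    x∈T    : x ∈ T
    w∈T    : w ∈ T
    s∈T    : s ∈ T
    x∼w    : E G x w
    x∼s    : E G x s
    w∼s    : E G w s
    x-nbrs : ∀ {u} → u ∈ T → E G x u → u ≡ w ⊎ u ≡ s
    w-nbrs : ∀ {u} → u ∈ T → E G w u → u ≡ x ⊎ u ≡ s

data Reducible (G : Graph n) (T : Subset n) : Set where
  complete         : IsComplete G (_∈ T) → Reducible G T
  dominated-pair   : ∀ {x y} → Dominated G T x y → Reducible G T
  pendant-edge     : ∀ {x w} → Pendant G T x w → Reducible G T
  pendant-triangle : ∀ {x w s} → PendantTriangle G T x w s → Reducible G T

four-distinct : ∀ {G : Graph n} {P : Fin n → Set} →
  (∀ (g : Fin 4 → Fin n) → Injective G g → ¬ (∀ i → P (g i))) →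
  ∀ {a b c d} → a ≢ b → a ≢ c → a ≢ d → b ≢ c → b ≢ d → c ≢ d → P a → P b → P c → P d → ⊥
four-distinct {P = P} at-most-three {a} {b} {c} {d} a≢b a≢c a≢d b≢c b≢d c≢d Pa Pb Pc Pd =
  at-most-three (lookup (a ∷ b ∷ c ∷ d ∷ []))
    (lookup-injective ((a≢b ∷ a≢c ∷ a≢d ∷ []) ∷ (b≢c ∷ b≢d ∷ []) ∷ (c≢d ∷ []) ∷ [] ∷ []))
    all-P
  where
  all-P : ∀ i → P (lookup (a ∷ b ∷ c ∷ d ∷ []) i)
  all-P fzero = Pa
  all-P (fsuc fzero) = Pb
  all-P (fsuc (fsuc fzero)) = Pc
  all-P (fsuc (fsuc (fsuc fzero))) = Pd

module _ {n : ℕ} (G : Graph n) {T : Subset n} where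

  private
    edge? : ∀ u v → Dec (E G u v)
    edge? u v = adj G u v Bool.≟ true

    sep? : ∀ x y z → Dec (Sep G (_∈ T) x y z)
    sep? x y z = (z ∈? T ×-dec edge? x z) ×-dec (z ∈? T ×-dec edge? y z)

  small-component-reducible : ∀ {x y} → TwoPair G (_∈ T) x y →
    (∀ u v → CxS G (_∈ T) x y u → CxS G (_∈ T) x y v → u ≢ v → E G u v) →
    (∀ (g : Fin 4 → Fin n) → Injective G g → ¬ (∀ i → CxS G (_∈ T) x y (g i))) →
    Reducible G T
  small-component-reducible {x} {y} (x∈T , y∈T , x≢y , _) clique at-most-three
    with any? (λ w → w ∈? T ×-dec edge? x w ×-dec ¬? (sep? x y w))
  ... | no none = dominated-pair record
    { x∈T = x∈T ; y∈T = y∈T ; x≢y = x≢y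
    ; dominated = λ {u} u∈T xu → decidable-stable (edge? y u)
                                   λ y≁u → none (u , u∈T , xu , λ sep → y≁u (proj₂ (proj₂ sep))) }
  ... | yes (w , w∈T , xw , w∉S) with any? (λ s → s ∈? T ×-dec edge? x s ×-dec ¬? (s ≟ w))
  ...   | no only-w = pendant-edge record
    { x∈T = x∈T ; w∈T = w∈T ; x∼w = xw
    ; unique = λ {u} u∈T xu → decidable-stable (u ≟ w) λ u≢w → only-w (u , u∈T , xu , u≢w) }
  ...   | yes (s , s∈T , xs , s≢w) = pendant-triangle record
    { x∈T = x∈T ; w∈T = w∈T ; s∈T = s∈T ; x∼w = xw ; x∼s = xs ; w∼s = w∼s
    ; x-nbrs = x-nbrs ; w-nbrs = w-nbrs }
    where
    x-reach : Reach G (_∈ T) x y x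
    x-reach = here x∈T λ sep → edge⇒≢ G (proj₂ (proj₁ sep)) refl
    w-reach : Reach G (_∈ T) x y w
    w-reach = step x-reach w∈T w∉S xw
    nbr-in-component : ∀ {u z} → Reach G (_∈ T) x y u → z ∈ T → E G u z → CxS G (_∈ T) x y z
    nbr-in-component {z = z} reach z∈T uz with sep? x y z
    ... | yes sep = inj₂ sep
    ... | no not-sep = inj₁ (step reach z∈T not-sep uz)
    w∼s : E G w s
    w∼s = clique w s (inj₁ w-reach) (nbr-in-component x-reach s∈T xs) (≢-sym s≢w)
    four : ∀ {u} → x ≢ u → w ≢ u → s ≢ u → CxS G (_∈ T) x y u → ⊥
    four x≢u w≢u s≢u u∈C = four-distinct {G = G} at-most-three
      (edge⇒≢ G xw) (edge⇒≢ G xs) x≢u (edge⇒≢ G w∼s) w≢u s≢u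
      (inj₁ x-reach) (inj₁ w-reach) (nbr-in-component x-reach s∈T xs) u∈C
    x-nbrs : ∀ {u} → u ∈ T → E G x u → u ≡ w ⊎ u ≡ s
    x-nbrs {u} u∈T xu with u ≟ w | u ≟ s
    ... | yes u≡w | _ = inj₁ u≡w
    ... | _ | yes u≡s = inj₂ u≡s
    ... | no u≢w | no u≢s =
      ⊥-elim (four (edge⇒≢ G xu) (≢-sym u≢w) (≢-sym u≢s) (nbr-in-component x-reach u∈T xu))
    w-nbrs : ∀ {u} → u ∈ T → E G w u → u ≡ x ⊎ u ≡ s
    w-nbrs {u} u∈T wu with u ≟ x | u ≟ s
    ... | yes u≡x | _ = inj₁ u≡x
    ... | _ | yes u≡s = inj₂ u≡s
    ... | no u≢x | no u≢s =
      ⊥-elim (four (≢-sym u≢x) (edge⇒≢ G wu) (≢-sym u≢s) (nbr-in-component w-reach u∈T wu))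

  compact-reducible : Compact G → Reducible G T
  compact-reducible (_ , decomposition) with decomposition (_∈ T)
  ... | inj₁ clique = complete clique
  ... | inj₂ (inj₁ (x , y , (x∈T , y∈T , x≢y , _) , nbrs⊆)) = dominated-pair record
    { x∈T = x∈T ; y∈T = y∈T ; x≢y = x≢y ; dominated = λ u∈T xu → proj₂ (nbrs⊆ _ (u∈T , xu)) }
  ... | inj₂ (inj₂ (x , y , two-pair , clique , at-most-three)) =
    small-component-reducible two-pair clique at-most-three

module Recolouring {n : ℕ} (G : Graph n) (K : ℕ) where

  Colouring : Set
  Colouring = Fin n → Fin K

  Move : Set
  Move = Fin n × Fin K

  infixl 6 _[_≔_]
  _[_≔_] : Colouring → Fin n → Fin K → Colouring
  f [ v ≔ c ] = updateAt f v (const c)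

  recolour-at : ∀ f v c → (f [ v ≔ c ]) v ≡ c
  recolour-at f v c = updateAt-updates v f

  recolour-off : ∀ {f v c u} → u ≢ v → (f [ v ≔ c ]) u ≡ f u
  recolour-off {f} {v} {c} {u} = updateAt-minimal u v f

  apply : Colouring → Move → Colouring
  apply f (v , c) = f [ v ≔ c ]

  run : Colouring → List Move → Colouring
  run = foldl apply

  ProperOn : Subset n → Colouring → Set
  ProperOn T f = ∀ {u v} → u ∈ T → v ∈ T → E G u v → f u ≢ f v

  Agree : Subset n → Colouring → Colouring → Set
  Agree T f g = ∀ {z} → z ∈ T → f z ≡ g z

  private
    variable
      R T U : Subset n
      f g h α β : Colouring
      u v x : Fin n
      c d : Fin K
      ms ns : List Move

  proper-⊆ : U ⊆ T → ProperOn T f → ProperOn U f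
  proper-⊆ U⊆T proper u∈U v∈U = proper (U⊆T u∈U) (U⊆T v∈U)

  proper-agree : Agree T f g → ProperOn T f → ProperOn T g
  proper-agree f≗g proper u∈T v∈T uv gu≡gv =
    proper u∈T v∈T uv (trans (f≗g u∈T) (trans gu≡gv (sym (f≗g v∈T))))

  proper-extend : ProperOn (T - x) g → (∀ {u} → u ∈ T → E G x u → g x ≢ g u) → ProperOn T g
  proper-extend {x = x} proper at-x {u} {v} u∈T v∈T uv with u ≟ x | v ≟ x
  ... | yes refl | _ = at-x v∈T uv
  ... | no _ | yes refl = ≢-sym (at-x u∈T (edge-sym G uv))
  ... | no u≢x | no v≢x = proper (x∈p∧x≢y⇒x∈p-y u∈T u≢x) (x∈p∧x≢y⇒x∈p-y v∈T v≢x) uv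

  recolour-proper : ProperOn T f → (∀ {u} → u ∈ T → E G v u → f u ≢ c) → ProperOn T (f [ v ≔ c ])
  recolour-proper {v = v} proper fresh = proper-extend
    (λ u∈ w∈ uw → subst₂ _≢_ (sym (recolour-off (x∈p-y⇒x≢y u∈))) (sym (recolour-off (x∈p-y⇒x≢y w∈)))
                          (proper (x∈p-y⇒x∈p u∈) (x∈p-y⇒x∈p w∈) uw))
    (λ u∈T vu → subst₂ _≢_ (sym (recolour-at _ v _)) (sym (recolour-off (≢-sym (edge⇒≢ G vu))))
                          (≢-sym (fresh u∈T vu)))

  agree-refl : Agree T f f
  agree-refl _ = refl

  agree-sym : Agree T f g → Agree T g f
  agree-sym f≗g z∈T = sym (f≗g z∈T)

  agree-trans : Agree T f g → Agree T g h → Agree T f h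
  agree-trans f≗g g≗h z∈T = trans (f≗g z∈T) (g≗h z∈T)

  agree-recolour : Agree T f g → Agree T (f [ v ≔ c ]) (g [ v ≔ c ])
  agree-recolour {v = v} f≗g {z} z∈T with z ≟ v
  ... | yes refl = trans (recolour-at _ v _) (sym (recolour-at _ v _))
  ... | no z≢v = trans (recolour-off z≢v) (trans (f≗g z∈T) (sym (recolour-off z≢v)))

  agree-recolour-outside : u ∉ T → Agree T f g → Agree T f (g [ u ≔ d ])
  agree-recolour-outside u∉T f≗g z∈T =
    trans (f≗g z∈T) (sym (recolour-off λ { refl → u∉T z∈T }))

  agree-extend : Agree (T - x) f g → f x ≡ g x → Agree T f g
  agree-extend {x = x} f≗g fx≡gx {z} z∈T with z ≟ x
  ... | yes refl = fx≡gx
  ... | no z≢x = f≗g (x∈p∧x≢y⇒x∈p-y z∈T z≢x)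

  data Walk (T : Subset n) : Colouring → List Move → Set where
    []   : Walk T f []
    step : v ∈ T → ProperOn T (f [ v ≔ c ]) → Walk T (f [ v ≔ c ]) ms → Walk T f ((v , c) ∷ ms)

  _++ʷ_ : Walk T f ms → Walk T (run f ms) ns → Walk T f (ms ++ ns)
  [] ++ʷ rest = rest
  step v∈T proper walk ++ʷ rest = step v∈T proper (walk ++ʷ rest)

  walk-proper : ProperOn T f → Walk T f ms → ProperOn T (run f ms)
  walk-proper proper [] = proper
  walk-proper _ (step _ proper walk) = walk-proper proper walk

  count : Fin n → List Move → ℕ
  count z = length ∘ filter ((_≟ z) ∘ proj₁)

  count-here : ∀ v c ms → count v ((v , c) ∷ ms) ≡ suc (count v ms)
  count-here v c ms = cong length (filter-accept ((_≟ v) ∘ proj₁) {x = v , c} {xs = ms} refl)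

  count-there : ∀ u c ms → u ≢ v → count v ((u , c) ∷ ms) ≡ count v ms
  count-there {v = v} u c ms u≢v = cong length (filter-reject ((_≟ v) ∘ proj₁) {xs = ms} u≢v)

  count-∷ : ∀ {z} m ms → count z (m ∷ ms) ≤ suc (count z ms)
  count-∷ {z} (u , c) ms = by-cases (u ≟ z)
    where
    by-cases : Dec (u ≡ z) → count z ((u , c) ∷ ms) ≤ suc (count z ms)
    by-cases (yes refl) = ≤-reflexive (count-here u c ms)
    by-cases (no u≢z) = m≤n⇒m≤1+n (≤-reflexive (count-there u c ms u≢z))

  count-∷-mono : ∀ {z} m → count z ms ≤ count z ns → count z (m ∷ ms) ≤ count z (m ∷ ns)
  count-∷-mono {ms} {ns} {z} (u , c) ms≤ns = by-cases (u ≟ z)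
    where
    by-cases : Dec (u ≡ z) → count z ((u , c) ∷ ms) ≤ count z ((u , c) ∷ ns)
    by-cases (yes refl) = subst₂ _≤_ (sym (count-here u c ms)) (sym (count-here u c ns)) (s≤s ms≤ns)
    by-cases (no u≢z) = subst₂ _≤_ (sym (count-there u c ms u≢z)) (sym (count-there u c ns u≢z)) ms≤ns

  count-≤-∷ : ∀ {z} m ms → count z ms ≤ count z (m ∷ ms)
  count-≤-∷ {z} (u , c) ms = by-cases (u ≟ z)
    where
    by-cases : Dec (u ≡ z) → count z ms ≤ count z ((u , c) ∷ ms)
    by-cases (yes refl) = ≤-trans (n≤1+n _) (≤-reflexive (sym (count-here u c ms)))
    by-cases (no u≢z) = ≤-reflexive (sym (count-there u c ms u≢z))

  count-++ : ∀ z ms ns → count z (ms ++ ns) ≡ count z ms + count z ns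
  count-++ z ms ns = trans (cong length (filter-++ ((_≟ z) ∘ proj₁) ms ns)) (length-++ (filter _ ms))

  count≤length : ∀ z ms → count z ms ≤ length ms
  count≤length z = length-filter ((_≟ z) ∘ proj₁)

  record WalkTo (T : Subset n) (f β : Colouring) (bound : ℕ) : Set where
    field
      moves   : List Move
      walk    : Walk T f moves
      reaches : Agree T (run f moves) β
      short   : length moves ≤ bound

  record Reconfiguration (T : Subset n) (α β : Colouring) : Set where
    field
      moves   : List Move
      walk    : Walk T α moves
      reaches : Agree T (run α moves) β
      short   : length moves ≤ 2 * (∣ T ∣ * ∣ T ∣)
      sparse  : ∀ z → count z moves ≤ 2 * ∣ T ∣

  -- A walk on T′ ⊆ T is replayed on T, each move of the anchor a possibly preceded by one move of a vertex
  -- outside T′; vertices outside T′ are thus recoloured at most as often as a.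
  module Lifting {T′ T : Subset n} (T′⊆T : T′ ⊆ T) (a : Fin n) (Inv : Colouring → Set) where

    data Detour (g : Colouring) (v : Fin n) (c : Fin K) : Set where
      direct : ProperOn T (g [ v ≔ c ]) → Inv (g [ v ≔ c ]) → Detour g v c
      via    : ∀ {u d} → v ≡ a → u ∈ T → u ∉ T′ →
               ProperOn T (g [ u ≔ d ]) → ProperOn T (g [ u ≔ d ] [ v ≔ c ]) →
               Inv (g [ u ≔ d ] [ v ≔ c ]) → Detour g v c

    Detours : Set
    Detours = ∀ {f g v c} → v ∈ T′ → ProperOn T′ f → ProperOn T′ (f [ v ≔ c ]) →
              Agree T′ f g → ProperOn T g → Inv g → Detour g v c

    record Lifted (f g : Colouring) (ms : List Move) : Set where
      field
        moves   : List Move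
        walk    : Walk T g moves
        agrees  : Agree T′ (run f ms) (run g moves)
        short   : length moves ≤ length ms + count a ms
        kept    : ∀ {z} → z ∈ T′ → count z moves ≤ count z ms
        removed : ∀ {z} → z ∉ T′ → count z moves ≤ count a ms

    lift : Detours → Walk T′ f ms → ProperOn T′ f → Agree T′ f g → ProperOn T g → Inv g → Lifted f g ms
    lift detours [] _ f≗g _ _ = record
      { moves = [] ; walk = [] ; agrees = f≗g ; short = z≤n ; kept = λ _ → z≤n ; removed = λ _ → z≤n }
    lift detours (step {v = v} {c = c} {ms = ms} v∈T′ proper′ walk) proper f≗g proper-g inv
      with detours v∈T′ proper proper′ f≗g proper-g inv
    ... | direct proper-g′ inv′ = record
      { moves   = (v , c) ∷ L.moves
      ; walk    = step (T′⊆T v∈T′) proper-g′ L.walk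
      ; agrees  = L.agrees
      ; short   = s≤s (≤-trans L.short (+-monoʳ-≤ (length ms) (count-≤-∷ (v , c) ms)))
      ; kept    = λ z∈T′ → count-∷-mono (v , c) (L.kept z∈T′)
      ; removed = λ z∉T′ → ≤-trans (≤-reflexive (count-there v c L.moves λ { refl → z∉T′ v∈T′ }))
                                    (≤-trans (L.removed z∉T′) (count-≤-∷ (v , c) ms))
      }
      where
      module L = Lifted (lift detours walk proper′ (agree-recolour f≗g) proper-g′ inv′)
    ... | via {u} {d} refl u∈T u∉T′ proper-g₁ proper-g₂ inv′ = record
      { moves   = (u , d) ∷ (a , c) ∷ L.moves
      ; walk    = step u∈T proper-g₁ (step (T′⊆T v∈T′) proper-g₂ L.walk)
      ; agrees  = L.agrees
      ; short   = s≤s (≤-trans (s≤s L.short) (≤-reflexive (sym a-counted)))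
      ; kept    = λ z∈T′ → ≤-trans (≤-reflexive (count-there u d _ λ { refl → u∉T′ z∈T′ }))
                                    (count-∷-mono (a , c) (L.kept z∈T′))
      ; removed = removed
      }
      where
      open ≤-Reasoning
      module L = Lifted
        (lift detours walk proper′ (agree-recolour (agree-recolour-outside u∉T′ f≗g)) proper-g₂ inv′)
      a-counted : length ms + count a ((a , c) ∷ ms) ≡ suc (length ms + count a ms)
      a-counted = trans (cong (length ms +_) (count-here a c ms)) (+-suc _ _)
      removed : ∀ {z} → z ∉ T′ → count z ((u , d) ∷ (a , c) ∷ L.moves) ≤ count a ((a , c) ∷ ms)
      removed {z} z∉T′ = begin
        count z ((u , d) ∷ (a , c) ∷ L.moves) ≤⟨ count-∷ (u , d) _ ⟩
        suc (count z ((a , c) ∷ L.moves))     ≡⟨ cong suc (count-there a c L.moves λ { refl → z∉T′ v∈T′ }) ⟩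
        suc (count z L.moves)                 ≤⟨ s≤s (L.removed z∉T′) ⟩
        suc (count a ms)                      ≡⟨ count-here a c ms ⟨
        count a ((a , c) ∷ ms)                ∎

    record Approach (g β : Colouring) : Set where
      field
        moves   : List Move
        walk    : Walk T g moves
        reaches : Agree T′ (run g moves) β
        short   : length moves ≤ 2 * (∣ T′ ∣ * ∣ T′ ∣) + 2 * ∣ T′ ∣
        sparse  : ∀ z → count z moves ≤ 2 * ∣ T′ ∣

    approach : ∀ {α β} → Detours → Reconfiguration T′ α β → ProperOn T′ α →
               Agree T′ α g → ProperOn T g → Inv g → Approach g β
    approach detours R proper-α α≗g proper-g inv = record
      { moves   = L.moves
      ; walk    = L.walk
      ; reaches = agree-trans (agree-sym L.agrees) R.reaches
      ; short   = ≤-trans L.short (+-mono-≤ R.short (R.sparse a))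
      ; sparse  = λ z → by-cases z (z ∈? T′)
      }
      where
      module R = Reconfiguration R
      module L = Lifted (lift detours R.walk proper-α α≗g proper-g inv)
      by-cases : ∀ z → Dec (z ∈ T′) → count z L.moves ≤ 2 * ∣ T′ ∣
      by-cases z (yes z∈T′) = ≤-trans (L.kept z∈T′) (R.sparse z)
      by-cases z (no z∉T′) = ≤-trans (L.removed z∉T′) (R.sparse a)

    assemble : ∀ r {α β} pre post → r + ∣ T′ ∣ < ∣ T ∣ → length pre + length post ≤ 2 + r →
               Walk T α pre → (A : Approach (run α pre) β) →
               Walk T (run (run α pre) (Approach.moves A)) post →
               Agree T (run (run (run α pre) (Approach.moves A)) post) β → Reconfiguration T α β
    assemble r {α} {β} pre post smaller extra pre-walk A post-walk settled = record
      { moves   = pre ++ A.moves ++ post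
      ; walk    = pre-walk ++ʷ (A.walk ++ʷ post-walk)
      ; reaches = subst (λ h → Agree T h β) (sym run-split) settled
      ; short   = subst (_≤ 2 * (∣ T ∣ * ∣ T ∣)) (sym length-split)
                    (quadratic-budget r smaller A.short extra)
      ; sparse  = λ z → ≤-trans (≤-reflexive (count-split z))
                    (linear-budget r smaller (A.sparse z)
                      (≤-trans (+-mono-≤ (count≤length z pre) (count≤length z post)) extra))
      }
      where
      module A = Approach A
      interchange : ∀ a b c → a + (b + c) ≡ b + (a + c)
      interchange = solve-∀
      run-split : run α (pre ++ A.moves ++ post) ≡ run (run (run α pre) A.moves) post
      run-split = trans (foldl-++ apply α pre (A.moves ++ post)) (foldl-++ apply (run α pre) A.moves post)
      length-split : length (pre ++ A.moves ++ post) ≡ length A.moves + (length pre + length post)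
      length-split = trans (trans (length-++ pre) (cong (length pre +_) (length-++ A.moves)))
                           (interchange (length pre) (length A.moves) (length post))
      count-split : ∀ z → count z (pre ++ A.moves ++ post) ≡ count z A.moves + (count z pre + count z post)
      count-split z = trans (trans (count-++ z pre _) (cong (count z pre +_) (count-++ z A.moves post)))
                            (interchange (count z pre) (count z A.moves) (count z post))

  settle : x ∈ T → ProperOn T g → Agree (T - x) h g → WalkTo T h g 1
  settle {x = x} {g = g} {h = h} x∈T proper-g h≗g = record
    { moves   = [ (x , g x) ]
    ; walk    = step x∈T (proper-agree (agree-sym settled) proper-g) []
    ; reaches = settled
    ; short   = ≤-refl
    }
    where
    settled : Agree _ (h [ x ≔ g x ]) g
    settled = agree-extend (agree-trans (agree-sym (agree-recolour-outside x∉p-x (agree-refl {f = h}))) h≗g)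
                           (recolour-at h x (g x))

  Smaller : Subset n → Set
  Smaller T = ∀ {U} → U ⊂ T → ∀ {α β} → ProperOn U α → ProperOn U β → Reconfiguration U α β

  module _ {T : Subset n} {x y : Fin n} (D : Dominated G T x y) where
    open Dominated D

    private
      T′ = T - x

      y∈T′ : y ∈ T′
      y∈T′ = x∈p∧x≢y⇒x∈p-y y∈T (≢-sym x≢y)

      nbr∈T′ : ∀ {u} → u ∈ T → E G x u → u ∈ T′
      nbr∈T′ u∈T xu = x∈p∧x≢y⇒x∈p-y u∈T (≢-sym (edge⇒≢ G xu))

    takes-colour-of-y : ProperOn T′ f → ProperOn T′ g → g x ≡ f y →
                        (∀ {u} → u ∈ T′ → E G y u → g u ≡ f u) → ProperOn T g
    takes-colour-of-y proper-f proper-g gx≡fy g≗f = proper-extend proper-g λ u∈T xu gx≡gu →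
      proper-f y∈T′ (nbr∈T′ u∈T xu) (dominated u∈T xu)
        (trans (sym gx≡fy) (trans gx≡gu (g≗f (nbr∈T′ u∈T xu) (dominated u∈T xu))))

    follow-y : Lifting.Detours x∈p-y⇒x∈p y (λ g → g x ≡ g y)
    follow-y {f} {g} {v} {c} v∈T′ proper-f proper-f′ f≗g _ gx≡gy with v ≟ y
    ... | yes refl = Lifting.via refl x∈T x∉p-x proper-g₁ proper-g₂ g₂x≡g₂y
      where
      g₁≗f : Agree T′ (g [ x ≔ c ]) f
      g₁≗f = agree-sym (agree-recolour-outside x∉p-x f≗g)
      proper-g₁ = takes-colour-of-y proper-f′ (proper-agree (agree-sym g₁≗f) proper-f)
        (trans (recolour-at g x c) (sym (recolour-at f _ c)))
        λ u∈T′ yu → trans (g₁≗f u∈T′) (sym (recolour-off (≢-sym (edge⇒≢ G yu))))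
      f′≗g₂ : Agree T′ (f [ y ≔ c ]) (g [ x ≔ c ] [ y ≔ c ])
      f′≗g₂ = agree-recolour (agree-recolour-outside x∉p-x f≗g)
      g₂x≡g₂y = trans (recolour-off x≢y) (trans (recolour-at g x c) (sym (recolour-at _ y c)))
      proper-g₂ = takes-colour-of-y proper-f′ (proper-agree f′≗g₂ proper-f′)
        (trans g₂x≡g₂y (sym (f′≗g₂ y∈T′))) (λ u∈T′ _ → sym (f′≗g₂ u∈T′))
    ... | no v≢y = Lifting.direct proper-g′ g′x≡g′y
      where
      f′≗g′ : Agree T′ (f [ v ≔ c ]) (g [ v ≔ c ])
      f′≗g′ = agree-recolour f≗g
      g′x≡g′y = trans (recolour-off λ { refl → x∉p-x v∈T′ }) (trans gx≡gy (sym (recolour-off (≢-sym v≢y))))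
      proper-g′ = takes-colour-of-y proper-f′ (proper-agree f′≗g′ proper-f′)
        (trans g′x≡g′y (sym (f′≗g′ y∈T′))) (λ u∈T′ _ → sym (f′≗g′ u∈T′))

    reconfigure-dominated : Smaller T → ProperOn T α → ProperOn T β → Reconfiguration T α β
    reconfigure-dominated {α = α} {β = β} smaller proper-α proper-β =
      assemble 0 [ (x , α y) ] S.moves (p⊂q⇒∣p∣<∣q∣ T′⊂T) (s≤s S.short) (step x∈T proper-g₀ []) A
        S.walk S.reaches
      where
      open Lifting {T′} x∈p-y⇒x∈p y (λ g → g x ≡ g y) using (approach; assemble; module Approach)
      T′⊂T = x∈p⇒p-x⊂p x∈T
      proper-α′ = proper-⊆ x∈p-y⇒x∈p proper-α
      α≗g₀ : Agree T′ α (α [ x ≔ α y ])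
      α≗g₀ = agree-recolour-outside x∉p-x (agree-refl {f = α})
      proper-g₀ = takes-colour-of-y proper-α′ (proper-agree α≗g₀ proper-α′) (recolour-at α x (α y))
        λ u∈T′ _ → sym (α≗g₀ u∈T′)
      A = approach follow-y (smaller T′⊂T proper-α′ (proper-⊆ x∈p-y⇒x∈p proper-β)) proper-α′ α≗g₀
            proper-g₀ (trans (recolour-at α x (α y)) (α≗g₀ y∈T′))
      module S = WalkTo (settle x∈T proper-β (Approach.reaches A))

  module _ {T : Subset n} {x w : Fin n} (P : Pendant G T x w) (2<K : 2 < K) where
    open Pendant P

    private
      T′ = T - x

      x≢w : x ≢ w
      x≢w = edge⇒≢ G x∼w

    pendant-proper : ∀ {a b} → ProperOn T′ g → g x ≡ a → g w ≡ b → a ≢ b → ProperOn T g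
    pendant-proper {g} proper-g refl gw≡b a≢b = proper-extend proper-g λ u∈T xu →
      subst (λ u → g x ≢ g u) (sym (unique u∈T xu)) λ gx≡gw → a≢b (trans gx≡gw gw≡b)

    dodge-w : Lifting.Detours x∈p-y⇒x∈p w (λ _ → Unit)
    dodge-w {g = g} {v} {c} v∈T′ _ proper-f′ f≗g proper-g _
      with v ≟ w | c ≟ g x | avoid₂ 2<K (g x) (g w)
    ... | no v≢w | _ | _ = Lifting.direct
      (pendant-proper (proper-agree (agree-recolour f≗g) proper-f′)
        (recolour-off λ { refl → x∉p-x v∈T′ }) (recolour-off (≢-sym v≢w)) (proper-g x∈T w∈T x∼w))
      tt
    ... | yes refl | no c≢gx | _ = Lifting.direct
      (pendant-proper (proper-agree (agree-recolour f≗g) proper-f′)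
        (recolour-off x≢w) (recolour-at g v c) (≢-sym c≢gx))
      tt
    ... | yes refl | yes refl | d , gx≢d , gw≢d = Lifting.via refl x∈T x∉p-x
      (pendant-proper (proper-agree g≗g₁ (proper-⊆ x∈p-y⇒x∈p proper-g))
        (recolour-at g x d) (recolour-off (≢-sym x≢w)) (≢-sym gw≢d))
      (pendant-proper (proper-agree (agree-recolour (agree-trans f≗g g≗g₁)) proper-f′)
        (trans (recolour-off x≢w) (recolour-at g x d)) (recolour-at _ v (g x)) (≢-sym gx≢d))
      tt
      where
      g≗g₁ : Agree T′ g (g [ x ≔ d ])
      g≗g₁ = agree-recolour-outside x∉p-x (agree-refl {f = g})

    reconfigure-pendant : Smaller T → ProperOn T α → ProperOn T β → Reconfiguration T α β
    reconfigure-pendant {α = α} {β = β} smaller proper-α proper-β =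
      assemble 0 [] S.moves (p⊂q⇒∣p∣<∣q∣ T′⊂T) (≤-trans S.short (n≤1+n 1)) [] A S.walk S.reaches
      where
      open Lifting {T′} x∈p-y⇒x∈p w (λ _ → Unit) using (approach; assemble; module Approach)
      T′⊂T = x∈p⇒p-x⊂p x∈T
      proper-α′ = proper-⊆ x∈p-y⇒x∈p proper-α
      A = approach dodge-w (smaller T′⊂T proper-α′ (proper-⊆ x∈p-y⇒x∈p proper-β)) proper-α′
            (agree-refl {f = α}) proper-α tt
      module S = WalkTo (settle x∈T proper-β (Approach.reaches A))

  module _ {T : Subset n} {x w s : Fin n} (P : PendantTriangle G T x w s) (3<K : 3 < K) where
    open PendantTriangle P

    private
      T′ = T - x - w

      T′⊆T : T′ ⊆ T
      T′⊆T = x∈p-y⇒x∈p ∘ x∈p-y⇒x∈p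

      x∉T′ : x ∉ T′
      x∉T′ = x∉p-x ∘ x∈p-y⇒x∈p

      w∉T′ : w ∉ T′
      w∉T′ = x∉p-x

      x≢w : x ≢ w
      x≢w = edge⇒≢ G x∼w

      x≢s : x ≢ s
      x≢s = edge⇒≢ G x∼s

      w≢s : w ≢ s
      w≢s = edge⇒≢ G w∼s

    triangle-proper : ∀ {a b e} → ProperOn T′ g → g x ≡ a → g w ≡ b → g s ≡ e →
                      a ≢ b → a ≢ e → b ≢ e → ProperOn T g
    triangle-proper {g} proper-g refl refl refl a≢b a≢e b≢e =
      proper-extend (proper-extend proper-g at-w) at-x
      where
      at-w : ∀ {u} → u ∈ T - x → E G w u → g w ≢ g u
      at-w u∈T-x wu with w-nbrs (x∈p-y⇒x∈p u∈T-x) wu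
      ... | inj₁ refl = ⊥-elim (x∉p-x u∈T-x)
      ... | inj₂ refl = b≢e
      at-x : ∀ {u} → u ∈ T → E G x u → g x ≢ g u
      at-x u∈T xu with x-nbrs u∈T xu
      ... | inj₁ refl = a≢b
      ... | inj₂ refl = a≢e

    dodge-s : Lifting.Detours T′⊆T s (λ _ → Unit)
    dodge-s {g = g} {v} {c} v∈T′ _ proper-f′ f≗g proper-g _
      with v ≟ s | c ≟ g x | c ≟ g w | avoid₃ 3<K (g x) (g w) (g s)
    ... | no v≢s | _ | _ | _ = Lifting.direct
      (triangle-proper (proper-agree (agree-recolour f≗g) proper-f′)
        (recolour-off λ { refl → x∉T′ v∈T′ }) (recolour-off λ { refl → w∉T′ v∈T′ })
        (recolour-off (≢-sym v≢s))
        (proper-g x∈T w∈T x∼w) (proper-g x∈T s∈T x∼s) (proper-g w∈T s∈T w∼s))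
      tt
    ... | yes refl | no c≢gx | no c≢gw | _ = Lifting.direct
      (triangle-proper (proper-agree (agree-recolour f≗g) proper-f′)
        (recolour-off x≢s) (recolour-off w≢s) (recolour-at g v c)
        (proper-g x∈T w∈T x∼w) (≢-sym c≢gx) (≢-sym c≢gw))
      tt
    ... | yes refl | yes refl | _ | d , gx≢d , gw≢d , gs≢d = Lifting.via refl x∈T x∉T′
      (triangle-proper (proper-agree g≗g₁ (proper-⊆ T′⊆T proper-g))
        (recolour-at g x d) (recolour-off (≢-sym x≢w)) (recolour-off (≢-sym x≢s))
        (≢-sym gw≢d) (≢-sym gs≢d) (proper-g w∈T s∈T w∼s))
      (triangle-proper (proper-agree (agree-recolour (agree-trans f≗g g≗g₁)) proper-f′)
        (trans (recolour-off x≢s) (recolour-at g x d)) (trans (recolour-off w≢s) (recolour-off (≢-sym x≢w)))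
        (recolour-at _ v (g x))
        (≢-sym gw≢d) (≢-sym gx≢d) (≢-sym (proper-g x∈T w∈T x∼w)))
      tt
      where
      g≗g₁ : Agree T′ g (g [ x ≔ d ])
      g≗g₁ = agree-recolour-outside x∉T′ (agree-refl {f = g})
    ... | yes refl | no c≢gx | yes refl | d , gx≢d , gw≢d , gs≢d = Lifting.via refl w∈T w∉T′
      (triangle-proper (proper-agree g≗g₁ (proper-⊆ T′⊆T proper-g))
        (recolour-off x≢w) (recolour-at g w d) (recolour-off (≢-sym w≢s))
        gx≢d (proper-g x∈T s∈T x∼s) (≢-sym gs≢d))
      (triangle-proper (proper-agree (agree-recolour (agree-trans f≗g g≗g₁)) proper-f′)
        (trans (recolour-off x≢s) (recolour-off x≢w)) (trans (recolour-off w≢s) (recolour-at g w d))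
        (recolour-at _ v (g w))
        gx≢d (proper-g x∈T w∈T x∼w) (≢-sym gw≢d))
      tt
      where
      g≗g₁ : Agree T′ g (g [ w ≔ d ])
      g≗g₁ = agree-recolour-outside w∉T′ (agree-refl {f = g})

    settle-triangle : ProperOn T h → ProperOn T β → Agree T′ h β → WalkTo T h β 3
    settle-triangle {h = h} {β = β} proper-h proper-β h≗β with avoid₃ 3<K (h x) (β x) (β s)
    ... | e , hx≢e , βx≢e , βs≢e = record
      { moves   = (w , e) ∷ (x , β x) ∷ (w , β w) ∷ []
      ; walk    = step w∈T proper-h₁ (step x∈T proper-h₂
                    (step w∈T (proper-agree (agree-sym settled) proper-β) []))
      ; reaches = settled
      ; short   = ≤-refl
      }
      where
      h₁ = h [ w ≔ e ]
      h₂ = h₁ [ x ≔ β x ]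
      h₃ = h₂ [ w ≔ β w ]
      proper-β′ = proper-⊆ T′⊆T proper-β
      β≗h₁ : Agree T′ β h₁
      β≗h₁ = agree-trans (agree-sym h≗β) (agree-recolour-outside w∉T′ (agree-refl {f = h}))
      β≗h₂ : Agree T′ β h₂
      β≗h₂ = agree-trans β≗h₁ (agree-recolour-outside x∉T′ (agree-refl {f = h₁}))
      settled : Agree T h₃ β
      β≗h₃ : Agree T′ β h₃
      β≗h₃ = agree-trans β≗h₂ (agree-recolour-outside w∉T′ (agree-refl {f = h₂}))
      settled = agree-extend (agree-extend (agree-sym β≗h₃) (recolour-at h₂ w (β w)))
                             (trans (recolour-off x≢w) (recolour-at h₁ x (β x)))
      hs≡βs : h s ≡ β s
      hs≡βs = h≗β (x∈p∧x≢y⇒x∈p-y (x∈p∧x≢y⇒x∈p-y s∈T (≢-sym x≢s)) (≢-sym w≢s))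
      h₁s≡βs : h₁ s ≡ β s
      h₁s≡βs = trans (recolour-off (≢-sym w≢s)) hs≡βs
      proper-h₁ = triangle-proper (proper-agree β≗h₁ proper-β′) (recolour-off x≢w) (recolour-at h w e) h₁s≡βs
        hx≢e (λ hx≡βs → proper-h x∈T s∈T x∼s (trans hx≡βs (sym hs≡βs))) (≢-sym βs≢e)
      proper-h₂ = triangle-proper (proper-agree β≗h₂ proper-β′) (recolour-at h₁ x (β x))
        (trans (recolour-off (≢-sym x≢w)) (recolour-at h w e)) (trans (recolour-off (≢-sym x≢s)) h₁s≡βs)
        βx≢e (proper-β x∈T s∈T x∼s) (≢-sym βs≢e)

    reconfigure-triangle : Smaller T → ProperOn T α → ProperOn T β → Reconfiguration T α β
    reconfigure-triangle {α = α} {β = β} smaller proper-α proper-β =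
      assemble 1 [] S.moves (≤-trans (s≤s (p⊂q⇒∣p∣<∣q∣ T′⊂T-x)) (p⊂q⇒∣p∣<∣q∣ T-x⊂T)) S.short [] A
        S.walk S.reaches
      where
      open Lifting T′⊆T s (λ _ → Unit) using (approach; assemble; module Approach)
      T′⊂T-x = x∈p⇒p-x⊂p (x∈p∧x≢y⇒x∈p-y w∈T (≢-sym x≢w))
      T-x⊂T = x∈p⇒p-x⊂p x∈T
      proper-α′ = proper-⊆ T′⊆T proper-α
      A = approach dodge-s (smaller (⊂-trans T′⊂T-x T-x⊂T) proper-α′ (proper-⊆ T′⊆T proper-β)) proper-α′
            (agree-refl {f = α}) proper-α tt
      module A = Approach A
      module S = WalkTo (settle-triangle (walk-proper proper-α A.walk) proper-β A.reaches)

  module _ {T : Subset n} {β : Colouring} (clique : IsComplete G (_∈ T))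
           (missing : ∀ (f : Colouring) → ∃ λ (d : Fin K) → ∀ {v} → v ∈ T → f v ≢ d)
           (proper-β : ProperOn T β) where

    Settled : Subset n → Colouring → Set
    Settled R f = ∀ {z} → z ∈ T → z ∉ R → f z ≡ β z

    Vacated : Fin n → Subset n → Colouring → Set
    Vacated x R f = ∃ λ pre → length pre ≤ 1 × Walk T f pre × Settled R (run f pre) ×
                              (∀ {u} → u ∈ T - x → run f pre u ≢ β x)

    private
      distinct-colours : ProperOn T f → ∀ {u v} → u ∈ T → v ∈ T → u ≢ v → f u ≢ f v
      distinct-colours proper-f u∈T v∈T u≢v = proper-f u∈T v∈T (clique _ _ u∈T v∈T u≢v)

    settle-one : Settled R f → Settled (R - x) (f [ x ≔ β x ])
    settle-one {x = x} settled {z} z∈T z∉R-x with z ≟ x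
    ... | yes refl = recolour-at _ z (β z)
    ... | no z≢x = trans (recolour-off z≢x) (settled z∈T λ z∈R → z∉R-x (x∈p∧x≢y⇒x∈p-y z∈R z≢x))

    place : x ∈ T → ProperOn T f → (∀ {u} → u ∈ T - x → f u ≢ β x) → ProperOn T (f [ x ≔ β x ])
    place x∈T proper-f unused = recolour-proper proper-f λ u∈T xu →
      unused (x∈p∧x≢y⇒x∈p-y u∈T (≢-sym (edge⇒≢ G xu)))

    holder-unsettled : Settled R f → x ∈ T → u ∈ T - x → f u ≡ β x → u ∈ R
    holder-unsettled {R = R} {u = u} settled x∈T u∈T-x fu≡βx with u ∈? R
    ... | yes u∈R = u∈R
    ... | no u∉R = ⊥-elim (distinct-colours proper-β (x∈p-y⇒x∈p u∈T-x) x∈T (x∈p-y⇒x≢y u∈T-x)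
                            (trans (sym (settled (x∈p-y⇒x∈p u∈T-x) u∉R)) fu≡βx))

    vacate : x ∈ T → ProperOn T f → Settled R f → Vacated x R f
    vacate {x = x} {f = f} x∈T proper-f settled
      with any? (λ u → u ∈? T - x ×-dec f u ≟ β x) | missing f
    ... | no unoccupied | _ = [] , z≤n , [] , settled , λ u∈T-x fu≡βx → unoccupied (_ , u∈T-x , fu≡βx)
    ... | yes (u , u∈T-x , fu≡βx) | d , d-unused =
      [ (u , d) ] , ≤-refl , step u∈T proper-f₁ [] , settled₁ , unused
      where
      u∈T = x∈p-y⇒x∈p u∈T-x
      proper-f₁ = recolour-proper proper-f λ z∈T _ → d-unused z∈T
      settled₁ : Settled _ (f [ u ≔ d ])
      settled₁ z∈T z∉R = trans (recolour-off λ { refl → z∉R (holder-unsettled settled x∈T u∈T-x fu≡βx) })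
                               (settled z∈T z∉R)
      unused : ∀ {z} → z ∈ T - x → (f [ u ≔ d ]) z ≢ β x
      unused {z} z∈T-x f₁z≡βx with z ≟ u
      ... | yes refl = d-unused u∈T (trans fu≡βx (sym (trans (sym (recolour-at f z d)) f₁z≡βx)))
      ... | no z≢u = distinct-colours proper-f (x∈p-y⇒x∈p z∈T-x) u∈T z≢u
                       (trans (sym (recolour-off z≢u)) (trans f₁z≡βx (sym fu≡βx)))

    clique-walk : ∀ {R} → Acc _⊂_ R → R ⊆ T → ProperOn T f → Settled R f → WalkTo T f β (2 * ∣ R ∣)
    clique-walk {f = f} {R} (acc smaller) R⊆T proper-f settled with any? (_∈? R)
    ... | no empty = record
      { moves = [] ; walk = [] ; reaches = λ z∈T → settled z∈T λ z∈R → empty (_ , z∈R) ; short = z≤n }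
    ... | yes (x , x∈R) = continue (vacate (R⊆T x∈R) proper-f settled)
      where
      continue : Vacated x R f → WalkTo T f β (2 * ∣ R ∣)
      continue (pre , pre≤1 , pre-walk , settled′ , unused) = record
        { moves   = pre ++ (x , β x) ∷ W.moves
        ; walk    = pre-walk ++ʷ step (R⊆T x∈R) placed W.walk
        ; reaches = subst (λ h → Agree T h β) (sym (foldl-++ apply f pre _)) W.reaches
        ; short   = subst (_≤ 2 * ∣ R ∣) (sym length-split)
                      (linear-budget 0 (p⊂q⇒∣p∣<∣q∣ (x∈p⇒p-x⊂p x∈R)) W.short (s≤s pre≤1))
        }
        where
        placed = place (R⊆T x∈R) (walk-proper proper-f pre-walk) unused
        module W = WalkTo
          (clique-walk (smaller (x∈p⇒p-x⊂p x∈R)) (R⊆T ∘ x∈p-y⇒x∈p) placed (settle-one settled′))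
        length-split : length (pre ++ (x , β x) ∷ W.moves) ≡ length W.moves + suc (length pre)
        length-split = trans (length-++ pre) (trans (+-suc (length pre) _)
                         (trans (cong suc (+-comm (length pre) _)) (sym (+-suc _ _))))

    reconfigure-clique : ProperOn T α → Reconfiguration T α β
    reconfigure-clique proper-α = record
      { moves   = W.moves
      ; walk    = W.walk
      ; reaches = W.reaches
      ; short   = ≤-trans W.short (*-monoʳ-≤ 2 (n≤n*n ∣ T ∣))
      ; sparse  = λ z → ≤-trans (count≤length z W.moves) W.short
      }
      where
      module W = WalkTo (clique-walk (⊂-wellFounded T) (λ z∈T → z∈T) proper-α λ z∈T z∉T → ⊥-elim (z∉T z∈T))
      n≤n*n : ∀ t → t ≤ t * t
      n≤n*n zero = z≤n
      n≤n*n (suc t) = m≤m*n (suc t) (suc t)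

  proper⇒colouring : ProperOn ⊤ f → IsColouring G K f
  proper⇒colouring proper-f u v uv = proper-f ∈⊤ ∈⊤ uv

  colouring⇒proper : IsColouring G K f → ProperOn T f
  colouring⇒proper colouring-f _ _ uv = colouring-f _ _ uv

  recolour-noop : f v ≡ c → ∀ u → (f [ v ≔ c ]) u ≡ f u
  recolour-noop {f = f} {v = v} refl u with u ≟ v
  ... | yes refl = recolour-at f u (f u)
  ... | no u≢v = recolour-off u≢v

  walk-to-reconfiguration-graph : ProperOn ⊤ f → Walk ⊤ f ms → Agree ⊤ (run f ms) β →
                                  Σ ℕ λ m → m ≤ length ms × WalkR G K f β m
  walk-to-reconfiguration-graph {f = f} proper-f [] reaches =
    0 , z≤n , (λ _ → f) , (λ _ → proper⇒colouring proper-f) , (λ _ → refl) , (λ _ → reaches ∈⊤) , λ ()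
  walk-to-reconfiguration-graph {f = f} proper-f (step {v = v} {c = c} _ proper-f′ walk) reaches
    with f v ≟ c | walk-to-reconfiguration-graph proper-f′ walk reaches
  ... | yes fv≡c | m , m≤ , s , colourings , starts , ends , steps =
    -- a move keeping the colour is not an edge of the reconfiguration graph, so it is dropped
    m , m≤n⇒m≤1+n m≤ , s , colourings , (λ u → trans (starts u) (recolour-noop fv≡c u)) , ends , steps
  ... | no fv≢c | m , m≤ , s , colourings , starts , ends , steps =
    suc m , s≤s m≤ , f ∷ᶠ s , colourings′ , (λ _ → refl) , ends , steps′
    where
    colourings′ : ∀ i → IsColouring G K ((f ∷ᶠ s) i)
    colourings′ fzero = proper⇒colouring proper-f
    colourings′ (fsuc i) = colourings i
    steps′ : ∀ i → DifferOnOne G ((f ∷ᶠ s) (inject₁ i)) ((f ∷ᶠ s) (fsuc i))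
    steps′ fzero = v , (λ fv≡s₀v → fv≢c (trans fv≡s₀v (trans (starts v) (recolour-at f v c))))
                     , λ u u≢v → sym (trans (starts u) (recolour-off u≢v))
    steps′ (fsuc i) = steps i

module _ {n k : ℕ} (G : Graph n) (compact : Compact G)
         {γ : Fin n → Fin (suc k)} (γ-proper : IsColouring G (suc k) γ) where
  open Recolouring G (suc (suc k))

  reconfigure : ∀ {T} → Acc _⊂_ T → ∀ {α β} → ProperOn T α → ProperOn T β → Reconfiguration T α β
  reconfigure {T} (acc smaller) with compact-reducible G {T} compact
  ... | complete clique = λ proper-α proper-β →
    reconfigure-clique clique (clique-missing-colour {G = G} γ-proper clique) proper-β proper-α
  ... | dominated-pair D = reconfigure-dominated D λ U⊂T → reconfigure (smaller U⊂T)
  ... | pendant-edge {x} {w} P = reconfigure-pendant P 2<K λ U⊂T → reconfigure (smaller U⊂T)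
    where
    2<K = s≤s (distinct₂⇒2≤ (γ x) (γ w) (γ-proper x w (Pendant.x∼w P)))
  ... | pendant-triangle {x} {w} {s} P = reconfigure-triangle P 3<K λ U⊂T → reconfigure (smaller U⊂T)
    where
    open PendantTriangle P
    3<K = s≤s (distinct₃⇒3≤ (γ x) (γ w) (γ s) (γ-proper x w x∼w) (γ-proper x s x∼s) (γ-proper w s w∼s))

reconfiguration-diameter : ∀ k n (G : Graph n) → Compact G → Colourable G (suc k) →
                           ConnectedDiamAtMost G (suc (suc k)) (2 * (n * n))
reconfiguration-diameter k n G compact (γ , γ-proper) α β α-colouring β-colouring =
  map₂ (map₁ (λ m≤ → ≤-trans m≤ short))
       (walk-to-reconfiguration-graph (colouring⇒proper α-colouring) R.walk R.reaches)
  where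
  open Recolouring G (suc (suc k))
  module R = Reconfiguration (reconfigure G compact γ-proper (⊂-wellFounded ⊤)
                               (colouring⇒proper α-colouring) (colouring⇒proper β-colouring))
  short : length R.moves ≤ 2 * (n * n)
  short = subst (λ t → length R.moves ≤ 2 * (t * t)) (∣⊤∣≡n n) R.short

theorem2 : Σ ℕ λ c → ∀ (k n : ℕ) (G : Graph n) → Compact G → Colourable G (suc k) →
    ConnectedDiamAtMost G (suc (suc k)) (c * (n * n))
theorem2 = 2 , reconfiguration-diameter
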